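{- For every integer $n$, \[ \sum_{k=1}^n L_k^{\,4} = 5F_{2n+1}F_{n-1}F_{n+2}+6n-5 . \]
   Context: $F_n$ and $L_n$ ($n\in\mathbb{Z}$) are the Fibonacci and Lucas numbers: $F_n=F_{n-1}+F_{n-2}$ with $F_0=0$, $F_1=1$; $L_n=L_{n-1}+L_{n-2}$ with $L_0=2$, $L_1=1$; extended to negative indices by $F_{ -n}=(-1)^{n-1}F_n$, $L_{ -n}=(-1)^nL_n$. For $n=0$ the sum $\sum_{k=1}^n$ is empty. For $n<0$ the sum follows the convention $\sum_{k=1}^n a_k=-\sum_{k=n+1}^{0}a_k$. -}

module Defs where

open import Data.Nat as ℕ using (ℕ; zero; suc)
open import Data.Integer using (ℤ; +_; -[1+_]; _+_; _*_; -_; _-_)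

fibℕ : ℕ → ℤ
fibℕ zero = + 0
fibℕ (suc zero) = + 1
fibℕ (suc (suc n)) = fibℕ (suc n) + fibℕ n

lucℕ : ℕ → ℤ
lucℕ zero = + 2
lucℕ (suc zero) = + 1
lucℕ (suc (suc n)) = lucℕ (suc n) + lucℕ n

sgn : ℕ → ℤ
sgn zero = + 1
sgn (suc n) = - sgn n

-- extension to negative indices: F_{-n} = (-1)^{n-1} F_n, L_{-n} = (-1)^n L_n
-- -[1+ m ] = -(m+1), so F_{-(m+1)} = (-1)^m F_{m+1}, L_{-(m+1)} = (-1)^{m+1} L_{m+1}
F : ℤ → ℤ
F (+ n) = fibℕ n
F -[1+ m ] = sgn m * fibℕ (suc m)

L : ℤ → ℤ
L (+ n) = lucℕ n
L -[1+ m ] = sgn (suc m) * lucℕ (suc m)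

sumℕ : (ℤ → ℤ) → ℕ → ℤ
sumℕ a zero = + 0
sumℕ a (suc n) = sumℕ a n + a (+ suc n)

-- sum_{k=n+1}^{0} a_k for n = -(m+1), i.e. k ranging over -m, ..., 0
sumNeg : (ℤ → ℤ) → ℕ → ℤ
sumNeg a zero = a (+ 0)
sumNeg a (suc m) = sumNeg a m + a (- (+ suc m))

-- sum_{k=1}^{n} a_k for n : ℤ, with the convention
-- sum_{k=1}^{n} a_k = - sum_{k=n+1}^{0} a_k for n < 0
sumTo : (ℤ → ℤ) → ℤ → ℤ
sumTo a (+ n) = sumℕ a n
sumTo a -[1+ m ] = - sumNeg a m

-- Both sides of the identity change by L(n+1)⁴ when n steps to n + 1, and they agree at n = 0,
-- so they agree on all of ℤ (the induction runs in both directions).  To compute the step of the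
-- right-hand side, write it as a polynomial in a = F(n+1), b = F(n) using F(2n+1) = a² + b²,
-- F(n-1) = a - b, F(n+2) = a + b; the shifted polynomial is in a + b, a, and L(n+1) = a + 2b.
-- The required polynomial identity holds only modulo Cassini's relation (a² - ab - b²)² = 1,
-- which is invariant because (a, b) ↦ (a + b, a) changes the sign of a² - ab - b².
module Submission where

open import Defs
open import Data.Integer
  using (ℤ; +_; -[1+_]; 0ℤ; 1ℤ; _+_; _*_; _-_; -_; _^_; pred)
  renaming (suc to sucℤ)
open import Data.Integer.Properties
  using (+-assoc; +-comm; +-identityˡ; +-identityʳ; *-distribʳ-+; suc-pred; +-0-abelianGroup)
open import Data.Integer.Tactic.RingSolver using (solve-∀)
open import Algebra.Properties.AbelianGroup +-0-abelianGroup using (∙-cancelʳ)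
open import Data.Nat using (zero; suc)
open import Data.Product using (_×_; _,_; proj₁)
open import Level using (Level)
open import Relation.Binary.PropositionalEquality
open ≡-Reasoning

private
  variable
    ℓ : Level
    A : Set ℓ

ℤ-induction : (P : ℤ → Set ℓ) → P 0ℤ →
              (∀ n → P n → P (sucℤ n)) → (∀ n → P (sucℤ n) → P n) → ∀ n → P n
ℤ-induction P p₀ up down (+ zero)        = p₀
ℤ-induction P p₀ up down (+ suc k)       = up (+ k) (ℤ-induction P p₀ up down (+ k))
ℤ-induction P p₀ up down -[1+ zero ]     = down -[1+ zero ] p₀
ℤ-induction P p₀ up down -[1+ suc m ]    = down -[1+ suc m ] (ℤ-induction P p₀ up down -[1+ m ])

suc-invariant⇒constant : (f : ℤ → A) → (∀ n → f (sucℤ n) ≡ f n) → ∀ n → f n ≡ f 0ℤ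
suc-invariant⇒constant f inv =
  ℤ-induction (λ n → f n ≡ f 0ℤ) refl
    (λ n eq → trans (inv n) eq) (λ n eq → trans (sym (inv n)) eq)

same-increments⇒≗ : (u v d : ℤ → ℤ) →
                    (∀ n → u (sucℤ n) ≡ u n + d (sucℤ n)) →
                    (∀ n → v (sucℤ n) ≡ v n + d (sucℤ n)) →
                    u 0ℤ ≡ v 0ℤ → u ≗ v
same-increments⇒≗ u v d u-step v-step u₀≡v₀ = ℤ-induction (λ n → u n ≡ v n) u₀≡v₀ up down
  where
  up : ∀ n → u n ≡ v n → u (sucℤ n) ≡ v (sucℤ n)
  up n eq = begin
    u (sucℤ n)          ≡⟨ u-step n ⟩
    u n + d (sucℤ n)    ≡⟨ cong (_+ d (sucℤ n)) eq ⟩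
    v n + d (sucℤ n)    ≡⟨ v-step n ⟨
    v (sucℤ n)          ∎
  down : ∀ n → u (sucℤ n) ≡ v (sucℤ n) → u n ≡ v n
  down n eq = ∙-cancelʳ (d (sucℤ n)) (u n) (v n) (begin
    u n + d (sucℤ n)    ≡⟨ u-step n ⟨
    u (sucℤ n)          ≡⟨ eq ⟩
    v (sucℤ n)          ≡⟨ v-step n ⟩
    v n + d (sucℤ n)    ∎)

sumTo-suc : (a : ℤ → ℤ) → ∀ n → sumTo a (sucℤ n) ≡ sumTo a n + a (sucℤ n)
sumTo-suc a (+ k)           = refl
sumTo-suc a -[1+ zero ]     = cancel (a 0ℤ)
  where
  cancel : ∀ x → 0ℤ ≡ - x + x
  cancel = solve-∀
sumTo-suc a -[1+ suc m ]    = cancel (sumNeg a m) (a -[1+ m ])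
  where
  cancel : ∀ x y → - x ≡ - (x + y) + y
  cancel = solve-∀

record Recurrent (u : ℤ → ℤ) : Set where
  constructor recurrent
  field
    recurrence : ∀ n → u (sucℤ (sucℤ n)) ≡ u (sucℤ n) + u n

recurrent-∘suc : ∀ {u} → Recurrent u → Recurrent (λ n → u (sucℤ n))
recurrent-∘suc (recurrent rec) = recurrent (λ n → rec (sucℤ n))

recurrent-shift : ∀ {u} → Recurrent u → ∀ k → Recurrent (λ n → u (n + k))
recurrent-shift {u} (recurrent rec) k = recurrent λ n → begin
  u (sucℤ (sucℤ n) + k)         ≡⟨ cong u (trans (+-assoc 1ℤ (sucℤ n) k) (cong sucℤ (+-assoc 1ℤ n k))) ⟩
  u (sucℤ (sucℤ (n + k)))       ≡⟨ rec (n + k) ⟩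
  u (sucℤ (n + k)) + u (n + k)  ≡⟨ cong (λ m → u m + u (n + k)) (+-assoc 1ℤ n k) ⟨
  u (sucℤ n + k) + u (n + k)    ∎

recurrent-+ : ∀ {u v} → Recurrent u → Recurrent v → Recurrent (λ n → u n + v n)
recurrent-+ {u} {v} (recurrent rec-u) (recurrent rec-v) = recurrent λ n → begin
  u (sucℤ (sucℤ n)) + v (sucℤ (sucℤ n))     ≡⟨ cong₂ _+_ (rec-u n) (rec-v n) ⟩
  (u (sucℤ n) + u n) + (v (sucℤ n) + v n)   ≡⟨ interchange (u (sucℤ n)) (u n) (v (sucℤ n)) (v n) ⟩
  (u (sucℤ n) + v (sucℤ n)) + (u n + v n)   ∎
  where
  interchange : ∀ a b c d → (a + b) + (c + d) ≡ (a + c) + (b + d)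
  interchange = solve-∀

recurrent-*ʳ : ∀ {u} → Recurrent u → ∀ c → Recurrent (λ n → u n * c)
recurrent-*ʳ {u} (recurrent rec) c =
  recurrent λ n → trans (cong (_* c) (rec n)) (*-distribʳ-+ c (u (sucℤ n)) (u n))

recurrent-unique : ∀ {u v} → Recurrent u → Recurrent v →
                   u 0ℤ ≡ v 0ℤ → u 1ℤ ≡ v 1ℤ → u ≗ v
recurrent-unique {u} {v} (recurrent rec-u) (recurrent rec-v) eq₀ eq₁ n =
  proj₁ (ℤ-induction AgreeAt (eq₀ , eq₁) up down n)
  where
  AgreeAt : ℤ → Set
  AgreeAt n = u n ≡ v n × u (sucℤ n) ≡ v (sucℤ n)
  up : ∀ n → AgreeAt n → AgreeAt (sucℤ n)
  up n (eq , eq′) = eq′ , (begin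
    u (sucℤ (sucℤ n))     ≡⟨ rec-u n ⟩
    u (sucℤ n) + u n      ≡⟨ cong₂ _+_ eq′ eq ⟩
    v (sucℤ n) + v n      ≡⟨ rec-v n ⟨
    v (sucℤ (sucℤ n))     ∎)
  down : ∀ n → AgreeAt (sucℤ n) → AgreeAt n
  down n (eq′ , eq″) = ∙-cancelʳ (u (sucℤ n)) (u n) (v n) (begin
    u n + u (sucℤ n)      ≡⟨ +-comm (u n) _ ⟩
    u (sucℤ n) + u n      ≡⟨ rec-u n ⟨
    u (sucℤ (sucℤ n))     ≡⟨ eq″ ⟩
    v (sucℤ (sucℤ n))     ≡⟨ rec-v n ⟩
    v (sucℤ n) + v n      ≡⟨ cong (_+ v n) eq′ ⟨
    u (sucℤ n) + v n      ≡⟨ +-comm _ (v n) ⟩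
    v n + u (sucℤ n)      ∎) , eq′

F-recurrence : ∀ n → F (sucℤ (sucℤ n)) ≡ F (sucℤ n) + F n
F-recurrence (+ k)                 = refl
F-recurrence -[1+ zero ]           = refl
F-recurrence -[1+ suc zero ]       = refl
F-recurrence -[1+ suc (suc j) ]    = signed (sgn j) (fibℕ (suc j)) (fibℕ (suc (suc j)))
  where
  signed : ∀ s x y → s * x ≡ - s * y + - - s * (y + x)
  signed = solve-∀

F-recurrent : Recurrent F
F-recurrent = recurrent F-recurrence

L-recurrence : ∀ n → L (sucℤ (sucℤ n)) ≡ L (sucℤ n) + L n
L-recurrence (+ k)                 = refl
L-recurrence -[1+ zero ]           = refl
L-recurrence -[1+ suc zero ]       = refl
L-recurrence -[1+ suc (suc j) ]    = signed (sgn (suc j)) (lucℕ (suc j)) (lucℕ (suc (suc j)))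
  where
  signed : ∀ s x y → s * x ≡ - s * y + - - s * (y + x)
  signed = solve-∀

L-recurrent : Recurrent L
L-recurrent = recurrent L-recurrence

L-suc≡F-suc-suc+F : ∀ n → L (sucℤ n) ≡ F (sucℤ (sucℤ n)) + F n
L-suc≡F-suc-suc+F = recurrent-unique
  (recurrent-∘suc L-recurrent)
  (recurrent-+ (recurrent-∘suc (recurrent-∘suc F-recurrent)) F-recurrent)
  refl refl

F-pred : ∀ n → F (pred n) ≡ F (sucℤ n) - F n
F-pred n = begin
  F (pred n)                   ≡⟨ add-sub (F n) (F (pred n)) ⟨
  (F n + F (pred n)) - F n     ≡⟨ cong (_- F n) recurrence ⟨
  F (sucℤ n) - F n             ∎
  where
  add-sub : ∀ x y → (x + y) - x ≡ y
  add-sub = solve-∀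
  recurrence : F (sucℤ n) ≡ F n + F (pred n)
  recurrence = subst (λ m → F (sucℤ m) ≡ F m + F (pred n)) (suc-pred n) (F-recurrence (pred n))

F-suc-+ : ∀ m n → F (sucℤ (m + n)) ≡ F (sucℤ m) * F (sucℤ n) + F m * F n
F-suc-+ m n = recurrent-unique
  (recurrent-shift (recurrent-∘suc F-recurrent) n)
  (recurrent-+ (recurrent-*ʳ (recurrent-∘suc F-recurrent) (F (sucℤ n)))
               (recurrent-*ʳ F-recurrent (F n)))
  (trans (cong (λ k → F (sucℤ k)) (+-identityˡ n)) (at-0 (F (sucℤ n)) (F n)))
  (trans (F-recurrence n) (at-1 (F (sucℤ n)) (F n)))
  m
  where
  at-0 : ∀ x y → x ≡ 1ℤ * x + 0ℤ * y
  at-0 = solve-∀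
  at-1 : ∀ x y → x + y ≡ 1ℤ * x + 1ℤ * y
  at-1 = solve-∀

cassiniForm : ℤ → ℤ → ℤ
cassiniForm a b = a * a - a * b - b * b

cassiniForm-step : ∀ a b → cassiniForm (a + b) a ≡ - cassiniForm a b
cassiniForm-step = identity
  where
  identity : ∀ a b → (a + b) * (a + b) - (a + b) * a - a * a ≡ - (a * a - a * b - b * b)
  identity = solve-∀

cassiniForm²-step : ∀ a b →
                    cassiniForm (a + b) a * cassiniForm (a + b) a ≡ cassiniForm a b * cassiniForm a b
cassiniForm²-step a b = begin
  cassiniForm (a + b) a * cassiniForm (a + b) a   ≡⟨ cong (λ x → x * x) (cassiniForm-step a b) ⟩
  - cassiniForm a b * - cassiniForm a b           ≡⟨ neg-square (cassiniForm a b) ⟩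
  cassiniForm a b * cassiniForm a b               ∎
  where
  neg-square : ∀ x → - x * - x ≡ x * x
  neg-square = solve-∀

cassini² : ∀ n → cassiniForm (F (sucℤ n)) (F n) * cassiniForm (F (sucℤ n)) (F n) ≡ 1ℤ
cassini² = suc-invariant⇒constant
  (λ n → cassiniForm (F (sucℤ n)) (F n) * cassiniForm (F (sucℤ n)) (F n))
  λ n → trans (cong (λ x → cassiniForm x (F (sucℤ n)) * cassiniForm x (F (sucℤ n))) (F-recurrence n))
              (cassiniForm²-step (F (sucℤ n)) (F n))

closedForm : ℤ → ℤ
closedForm n = + 5 * F (+ 2 * n + + 1) * F (n - + 1) * F (n + + 2) + + 6 * n - + 5

closedFormPoly : ℤ → ℤ → ℤ → ℤ
closedFormPoly a b n = + 5 * (a * a + b * b) * (a - b) * (a + b) + + 6 * n - + 5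

closedForm≡closedFormPoly : ∀ n → closedForm n ≡ closedFormPoly (F (sucℤ n)) (F n) n
closedForm≡closedFormPoly n =
  cong₃ (λ x y z → + 5 * x * y * z + + 6 * n - + 5) doubling shifted-down shifted-up
  where
  a b : ℤ
  a = F (sucℤ n)
  b = F n
  cong₃ : ∀ (f : ℤ → ℤ → ℤ → ℤ) {x x′ y y′ z z′} → x ≡ x′ → y ≡ y′ → z ≡ z′ → f x y z ≡ f x′ y′ z′
  cong₃ f refl refl refl = refl
  two-n+1 : ∀ n → + 2 * n + + 1 ≡ 1ℤ + (n + n)
  two-n+1 = solve-∀
  n+2 : ∀ n → n + + 2 ≡ 1ℤ + (1ℤ + n)
  n+2 = solve-∀
  doubling : F (+ 2 * n + + 1) ≡ a * a + b * b
  doubling = trans (cong F (two-n+1 n)) (F-suc-+ n n)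
  shifted-down : F (n - + 1) ≡ a - b
  shifted-down = trans (cong F (+-comm n -[1+ 0 ])) (F-pred n)
  shifted-up : F (n + + 2) ≡ a + b
  shifted-up = trans (cong F (n+2 n)) (F-recurrence n)

closedFormPoly-step : ∀ a b n → cassiniForm a b * cassiniForm a b ≡ 1ℤ →
                      closedFormPoly (a + b) a (sucℤ n) ≡ closedFormPoly a b n + (a + b + b) ^ 4
closedFormPoly-step a b n cassini = begin
  closedFormPoly (a + b) a (sucℤ n)      ≡⟨ identity a b n ⟩
  stepped + + 6 * (1ℤ - q * q)           ≡⟨ cong (λ x → stepped + + 6 * (1ℤ - x)) cassini ⟩
  stepped + 0ℤ                           ≡⟨ +-identityʳ stepped ⟩
  stepped                                ∎
  where
  q stepped : ℤ
  q = cassiniForm a b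
  stepped = closedFormPoly a b n + (a + b + b) ^ 4
  -- the solver does not see through _^_, so the fourth power is written out as its unfolding
  identity : ∀ a b n →
    + 5 * ((a + b) * (a + b) + a * a) * ((a + b) - a) * ((a + b) + a) + + 6 * (1ℤ + n) - + 5
      ≡ (+ 5 * (a * a + b * b) * (a - b) * (a + b) + + 6 * n - + 5)
        + (a + b + b) * ((a + b + b) * ((a + b + b) * ((a + b + b) * 1ℤ)))
        + + 6 * (1ℤ - (a * a - a * b - b * b) * (a * a - a * b - b * b))
  identity = solve-∀

closedForm-suc : ∀ n → closedForm (sucℤ n) ≡ closedForm n + L (sucℤ n) ^ 4
closedForm-suc n = begin
  closedForm (sucℤ n)                          ≡⟨ closedForm≡closedFormPoly (sucℤ n) ⟩
  closedFormPoly (F (sucℤ (sucℤ n))) a (sucℤ n) ≡⟨ cong (λ x → closedFormPoly x a (sucℤ n)) (F-recurrence n) ⟩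
  closedFormPoly (a + b) a (sucℤ n)            ≡⟨ closedFormPoly-step a b n (cassini² n) ⟩
  closedFormPoly a b n + (a + b + b) ^ 4       ≡⟨ cong₂ (λ x y → x + y ^ 4) (closedForm≡closedFormPoly n) L-in-F ⟨
  closedForm n + L (sucℤ n) ^ 4                ∎
  where
  a b : ℤ
  a = F (sucℤ n)
  b = F n
  L-in-F : L (sucℤ n) ≡ a + b + b
  L-in-F = trans (L-suc≡F-suc-suc+F n) (cong (_+ b) (F-recurrence n))

mainTheorem8 : (n : ℤ) →
    sumTo (λ k → L k ^ 4) n
      ≡ + 5 * F (+ 2 * n + + 1) * F (n - + 1) * F (n + + 2) + + 6 * n - + 5
mainTheorem8 = same-increments⇒≗ (sumTo (λ k → L k ^ 4)) closedForm (λ k → L k ^ 4)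
  (sumTo-suc (λ k → L k ^ 4)) closedForm-suc refl
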